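{- Let $m$ be an odd positive integer and let $\mathrm{MP}[1..m]$ be a feasible palindrome array. Then there exists a string $x$ (regular or indeterminate), of length $n=(m-1)/2$, such that the maximal palindrome array of $x^*$ equals $\mathrm{MP}$.
   Context: A letter is a nonempty set of characters from an alphabet $\Sigma$; letters $\ell_1,\ell_2$ match ($\ell_1\approx\ell_2$) iff $\ell_1\cap\ell_2\ne\emptyset$. For a string $x=x_1x_2\cdots x_n$ of letters, let $x^*[1..m]=\#x_1\#x_2\#\cdots\#x_n\#$ with $m=2n+1$, where $\#\notin\Sigma$ is a symbol that matches only itself. The maximal palindrome array $\mathrm{MP}=\mathrm{MP}_{x^*}[1..m]$ is defined by: $\mathrm{MP}[i]$ is the largest $r\ge 0$ such that $1\le i-r$, $i+r\le m$, and $x^*[i-k]\approx x^*[i+k]$ for all $1\le k\le r$ (the radius of the maximal palindrome centred at $i$). An array $\mathrm{MP}[1..m]$ ($m$ odd) is feasible if it has the form $\mathrm{MP}=0\,i_2\,i_3\cdots i_{m-1}\,0$ where for every $j\in\{2,\dots,m-1\}$: (a) $i_j$ is an integer with $1-(j\bmod 2)\le i_j\le\min(j-1,m-j)$; (b) $i_j$ is odd if and only if $j$ is even. -}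

module Defs where

open import Data.Nat using (ℕ; zero; suc; _+_; _*_; _∸_; _≤_; _%_; _⊓_)
open import Data.List using (List; []; _∷_; length)
open import Data.List.NonEmpty using (List⁺)
open import Data.List.Membership.Propositional using (_∈_)
open import Data.Product using (Σ; ∃; _×_)
open import Data.Empty using (⊥)
open import Relation.Nullary using (¬_)
open import Relation.Binary.PropositionalEquality using (_≡_)

-- Alphabet Σ = ℕ.  A letter is a nonempty (finite) set of characters,
-- represented as a nonempty list of characters.
Letter : Set
Letter = List⁺ ℕ

_≈L_ : Letter → Letter → Set
a ≈L b = ∃ λ c → (c ∈ Data.List.NonEmpty.toList a) × (c ∈ Data.List.NonEmpty.toList b)

data Sym : Set where
  hash : Sym
  letter : Letter → Sym

_≈_ : Sym → Sym → Set
hash ≈ hash = Data.Unit.⊤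
  where import Data.Unit
hash ≈ letter _ = ⊥
letter _ ≈ hash = ⊥
letter a ≈ letter b = a ≈L b

star : List Letter → List Sym
star [] = hash ∷ []
star (l ∷ ls) = hash ∷ letter l ∷ star ls

-- 1-based access x*[i]; out of range returns # (never used: all accesses
-- below are guarded by 1 ≤ i ≤ m).
_!_ : List Sym → ℕ → Sym
[] ! _ = hash
(s ∷ ss) ! zero = hash
(s ∷ ss) ! suc zero = s
(s ∷ ss) ! suc (suc i) = ss ! suc i

PalRadius : List Sym → ℕ → ℕ → Set
PalRadius y i r =
  (1 ≤ i ∸ r) × (r < i) × (i + r ≤ length y) ×
  (∀ k → 1 ≤ k → k ≤ r → (y ! (i ∸ k)) ≈ (y ! (i + k)))
  where open Data.Nat using (_<_)

IsMP : List Sym → ℕ → ℕ → Set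
IsMP y i r = PalRadius y i r × (∀ r′ → PalRadius y i r′ → r′ ≤ r)

Feasible : ℕ → (ℕ → ℕ) → Set
Feasible m MP =
  (MP 1 ≡ 0) × (MP m ≡ 0) ×
  (∀ j → 2 ≤ j → j ≤ m ∸ 1 →
     (1 ∸ (j % 2) ≤ MP j) × (MP j ≤ (j ∸ 1) ⊓ (m ∸ j)) ×
     ((MP j % 2 ≡ 1 → j % 2 ≡ 0) × (j % 2 ≡ 0 → MP j % 2 ≡ 1)))

{-# OPTIONS --safe #-}
-- Put a letter at every even position a of x*, containing one character for each pair
-- (c, ∣a − c∣) such that the prescribed palindrome at c reaches a (∣a − c∣ ≤ MP c).
-- Mirror positions i ∓ k then share the character of (i, k) whenever k ≤ MP i, so x* has a
-- palindrome of radius MP i at i.  Conversely a character shared by two letter positions names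
-- a centre equidistant from both, i.e. their midpoint.  The parity condition of feasibility
-- puts i ∓ (MP i + 1) at letter positions, and these share nothing because the pair
-- (i, MP i + 1) is not covered; so the palindrome at i is maximal.
module Submission where

open import Defs
open import Data.Nat using (ℕ; zero; suc; _+_; _*_; _∸_; _≤_; _<_; _%_; _/_; ∣_-_∣; parity; NonZero;
  z≤n; z<s; s≤s; s≤s⁻¹; _≟_; _≤?_)
open import Data.Nat.Properties
open import Data.Nat.DivMod using (m≡m%n+[m/n]*n; [m+kn]%n≡m%n; m<n⇒m%n≡m)
open import Data.Parity.Base as ℙ using (Parity; 0ℙ; 1ℙ)
open import Data.Parity.Properties as ℙₚ using (+-homo-+; suc-homo-⁻¹; p+p≡0ℙ)
open import Data.List using (List; []; _∷_; length; map; filter; upTo)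
open import Data.List.NonEmpty using (toList) renaming (_∷_ to _∷⁺_)
open import Data.List.Membership.Propositional using (_∈_)
open import Data.List.Membership.Propositional.Properties using (∈-upTo⁺; ∈-upTo⁻; ∈-map∘filter⁺; ∈-map∘filter⁻)
open import Data.List.Relation.Unary.Any using (here; there)
open import Data.Sum using (inj₁; inj₂)
open import Data.Product using (Σ; ∃-syntax; _×_; _,_; proj₁; proj₂)
open import Data.Unit using (tt)
open import Function using (_∘_)
open import Relation.Nullary using (¬_; yes; no; contradiction)
open import Relation.Binary.PropositionalEquality

m+n≡[m∸n]+[n+n] : ∀ {m n} → n ≤ m → m + n ≡ m ∸ n + (n + n)
m+n≡[m∸n]+[n+n] {m} {n} n≤m = trans (cong (_+ n) (sym (m∸n+n≡m n≤m))) (+-assoc (m ∸ n) n n)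

[m∸n]+[m+n]≡2m : ∀ {m n} → n ≤ m → m ∸ n + (m + n) ≡ 2 * m
[m∸n]+[m+n]≡2m {m} {n} n≤m = begin
  m ∸ n + (m + n)     ≡⟨ cong (m ∸ n +_) (+-comm m n) ⟩
  m ∸ n + (n + m)     ≡⟨ +-assoc (m ∸ n) n m ⟨
  m ∸ n + n + m       ≡⟨ cong (_+ m) (m∸n+n≡m n≤m) ⟩
  m + m               ≡⟨ cong (m +_) (+-identityʳ m) ⟨
  2 * m               ∎
  where open ≡-Reasoning

m+kn-injective : ∀ {n c c′ k k′} .{{_ : NonZero n}} → c < n → c′ < n →
                 c + k * n ≡ c′ + k′ * n → c ≡ c′ × k ≡ k′
m+kn-injective {n} {c} {c′} {k} {k′} c<n c′<n eq = c≡c′ , *-cancelʳ-≡ k k′ n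
  (+-cancelˡ-≡ c (k * n) (k′ * n) (trans eq (cong (_+ k′ * n) (sym c≡c′))))
  where
  open ≡-Reasoning
  c≡c′ : c ≡ c′
  c≡c′ = begin
    c                 ≡⟨ m<n⇒m%n≡m c<n ⟨
    c % n             ≡⟨ [m+kn]%n≡m%n c k n ⟨
    (c + k * n) % n   ≡⟨ cong (_% n) eq ⟩
    (c′ + k′ * n) % n ≡⟨ [m+kn]%n≡m%n c′ k′ n ⟩
    c′ % n            ≡⟨ m<n⇒m%n≡m c′<n ⟩
    c′                ∎

parity[1+n]≡parity[n]⁻¹ : ∀ n → parity (suc n) ≡ parity n ℙ.⁻¹
parity[1+n]≡parity[n]⁻¹ n = trans (sym (ℙₚ.⁻¹-involutive (parity (suc n)))) (cong ℙ._⁻¹ (suc-homo-⁻¹ n))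

parity[m+[n+n]]≡parity[m] : ∀ m n → parity (m + (n + n)) ≡ parity m
parity[m+[n+n]]≡parity[m] m n = begin
  parity (m + (n + n))          ≡⟨ +-homo-+ m (n + n) ⟩
  parity m ℙ.+ parity (n + n)   ≡⟨ cong (parity m ℙ.+_) (trans (+-homo-+ n n) (p+p≡0ℙ (parity n))) ⟩
  parity m ℙ.+ 0ℙ               ≡⟨ ℙₚ.+-identityʳ (parity m) ⟩
  parity m                      ∎
  where open ≡-Reasoning

parity[m+n]≡parity[m∸n] : ∀ {m n} → n ≤ m → parity (m + n) ≡ parity (m ∸ n)
parity[m+n]≡parity[m∸n] {m} {n} n≤m =
  trans (cong parity (m+n≡[m∸n]+[n+n] n≤m)) (parity[m+[n+n]]≡parity[m] (m ∸ n) n)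

parity[m∸n]≡0ℙ : ∀ {m n} → n ≤ m → parity n ≡ parity m → parity (m ∸ n) ≡ 0ℙ
parity[m∸n]≡0ℙ {m} {n} n≤m pn≡pm = ℙₚ.+-cancelʳ-≡ (parity n) (parity (m ∸ n)) 0ℙ (begin
  parity (m ∸ n) ℙ.+ parity n   ≡⟨ +-homo-+ (m ∸ n) n ⟨
  parity (m ∸ n + n)            ≡⟨ cong parity (m∸n+n≡m n≤m) ⟩
  parity m                      ≡⟨ pn≡pm ⟨
  parity n                      ∎)
  where open ≡-Reasoning

parity≡0ℙ⇒%2≡0 : ∀ n → parity n ≡ 0ℙ → n % 2 ≡ 0
parity≡0ℙ⇒%2≡0 zero          _ = refl
parity≡0ℙ⇒%2≡0 (suc (suc n)) p = parity≡0ℙ⇒%2≡0 n p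

parity≡1ℙ⇒%2≡1 : ∀ n → parity n ≡ 1ℙ → n % 2 ≡ 1
parity≡1ℙ⇒%2≡1 (suc zero)    _ = refl
parity≡1ℙ⇒%2≡1 (suc (suc n)) p = parity≡1ℙ⇒%2≡1 n p

%2≡1⇒parity≡1ℙ : ∀ n → n % 2 ≡ 1 → parity n ≡ 1ℙ
%2≡1⇒parity≡1ℙ (suc zero)    _ = refl
%2≡1⇒parity≡1ℙ (suc (suc n)) h = %2≡1⇒parity≡1ℙ n h

%2≡1⇒m≡1+[h+h] : ∀ m → m % 2 ≡ 1 → m ≡ suc ((m ∸ 1) / 2 + (m ∸ 1) / 2)
%2≡1⇒m≡1+[h+h] (suc m) odd = cong suc (begin
  m                 ≡⟨ m≡m%n+[m/n]*n m 2 ⟩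
  m % 2 + h * 2     ≡⟨ cong (_+ h * 2) (parity≡0ℙ⇒%2≡0 m parity[m]≡0ℙ) ⟩
  h * 2             ≡⟨ *-comm h 2 ⟩
  h + (h + 0)       ≡⟨ cong (h +_) (+-identityʳ h) ⟩
  h + h             ∎)
  where
  open ≡-Reasoning
  h : ℕ
  h = m / 2
  parity[m]≡0ℙ : parity m ≡ 0ℙ
  parity[m]≡0ℙ = trans (sym (suc-homo-⁻¹ m)) (cong ℙ._⁻¹ (%2≡1⇒parity≡1ℙ (suc m) odd))

odd⇔even⇒parity[1+p]≡parity[j] : ∀ p j → (p % 2 ≡ 1 → j % 2 ≡ 0) → (j % 2 ≡ 0 → p % 2 ≡ 1) →
                                   parity (suc p) ≡ parity j
odd⇔even⇒parity[1+p]≡parity[j] p j odd⇒even even⇒odd rewrite parity[1+n]≡parity[n]⁻¹ p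
  with parity p in pp | parity j in pj
... | 0ℙ | 1ℙ = refl
... | 1ℙ | 0ℙ = refl
... | 0ℙ | 0ℙ = contradiction (trans (sym (parity≡0ℙ⇒%2≡0 p pp)) (even⇒odd (parity≡0ℙ⇒%2≡0 j pj))) λ ()
... | 1ℙ | 1ℙ = contradiction (trans (sym (parity≡1ℙ⇒%2≡1 j pj)) (odd⇒even (parity≡1ℙ⇒%2≡1 p pp))) λ ()

∣[m∸n]-m∣≡n : ∀ {m n} → n ≤ m → ∣ m ∸ n - m ∣ ≡ n
∣[m∸n]-m∣≡n {m} {n} n≤m = trans (m≤n⇒∣m-n∣≡n∸m (m∸n≤m m n)) (m∸[m∸n]≡n n≤m)

∣[m+n]-m∣≡n : ∀ m n → ∣ m + n - m ∣ ≡ n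
∣[m+n]-m∣≡n m n = trans (m≤n⇒∣n-m∣≡n∸m (m≤m+n m n)) (m+n∸m≡n m n)

c∸a≡b∸c⇒a+b≡2c : ∀ {a b c} → a ≤ c → c ≤ b → c ∸ a ≡ b ∸ c → a + b ≡ 2 * c
c∸a≡b∸c⇒a+b≡2c {a} {b} {c} a≤c c≤b eq = begin
  a + b                 ≡⟨ cong (a +_) (m∸n+n≡m c≤b) ⟨
  a + (b ∸ c + c)       ≡⟨ cong (λ d → a + (d + c)) eq ⟨
  a + (c ∸ a + c)       ≡⟨ +-assoc a (c ∸ a) c ⟨
  a + (c ∸ a) + c       ≡⟨ cong (_+ c) (m+[n∸m]≡n a≤c) ⟩
  c + c                 ≡⟨ cong (c +_) (+-identityʳ c) ⟨
  2 * c                 ∎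
  where open ≡-Reasoning

equidistant⇒a+b≡2c : ∀ {a b c} → a ≢ b → ∣ a - c ∣ ≡ ∣ b - c ∣ → a + b ≡ 2 * c
equidistant⇒a+b≡2c {a} {b} {c} a≢b eq with ≤-total a c | ≤-total b c
... | inj₁ a≤c | inj₁ b≤c = contradiction
  (∸-cancelˡ-≡ a≤c b≤c (trans (sym (m≤n⇒∣m-n∣≡n∸m a≤c)) (trans eq (m≤n⇒∣m-n∣≡n∸m b≤c)))) a≢b
... | inj₂ c≤a | inj₂ c≤b = contradiction
  (∸-cancelʳ-≡ c≤a c≤b (trans (sym (m≤n⇒∣n-m∣≡n∸m c≤a)) (trans eq (m≤n⇒∣n-m∣≡n∸m c≤b)))) a≢b
... | inj₁ a≤c | inj₂ c≤b = c∸a≡b∸c⇒a+b≡2c a≤c c≤b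
  (trans (sym (m≤n⇒∣m-n∣≡n∸m a≤c)) (trans eq (m≤n⇒∣n-m∣≡n∸m c≤b)))
... | inj₂ c≤a | inj₁ b≤c = trans (+-comm a b) (c∸a≡b∸c⇒a+b≡2c b≤c c≤a
  (trans (sym (m≤n⇒∣m-n∣≡n∸m b≤c)) (trans (sym eq) (m≤n⇒∣n-m∣≡n∸m c≤a))))

Admissible : ℕ → (ℕ → ℕ) → Set
Admissible m MP = ∀ i → 1 ≤ i → i ≤ m → MP i < i × i + MP i ≤ m × parity (suc (MP i)) ≡ parity i

feasible⇒admissible : ∀ {m MP} → m % 2 ≡ 1 → Feasible m MP → Admissible m MP
feasible⇒admissible {suc m} {MP} odd (MP[1]≡0 , MP[m]≡0 , inner) (suc i) 1≤i i≤m
  with suc i ≟ 1 | suc i ≟ suc m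
... | yes refl | _ rewrite MP[1]≡0 = s≤s z≤n , i≤m , refl
... | no _ | yes refl rewrite MP[m]≡0 =
  1≤i , ≤-reflexive (+-identityʳ _) , sym (%2≡1⇒parity≡1ℙ (suc m) odd)
... | no i≢1 | no i≢m with inner (suc i) (≤∧≢⇒< 1≤i (i≢1 ∘ sym)) (s≤s⁻¹ (≤∧≢⇒< i≤m i≢m))
...   | _ , MP[i]≤ , odd⇒even , even⇒odd =
  s≤s (m≤n⊓o⇒m≤n i (m ∸ i) MP[i]≤) ,
  ≤-trans (+-monoʳ-≤ (suc i) (m≤n⊓o⇒m≤o i (m ∸ i) MP[i]≤)) (≤-reflexive (m+[n∸m]≡n i≤m)) ,
  odd⇔even⇒parity[1+p]≡parity[j] (MP (suc i)) (suc i) odd⇒even even⇒odd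

symbol : Parity → Letter → Sym
symbol 0ℙ l = letter l
symbol 1ℙ _ = hash

symbol-≈ : ∀ p {l l′} → l ≈L l′ → symbol p l ≈ symbol p l′
symbol-≈ 0ℙ l≈l′ = l≈l′
symbol-≈ 1ℙ _    = tt

evenLetters : (ℕ → Letter) → ℕ → List Letter
evenLetters L zero    = []
evenLetters L (suc n) = L 2 ∷ evenLetters (λ j → L (2 + j)) n

length-evenLetters : ∀ L n → length (evenLetters L n) ≡ n
length-evenLetters L zero    = refl
length-evenLetters L (suc n) = cong suc (length-evenLetters _ n)

length-star : ∀ xs → length (star xs) ≡ suc (length xs + length xs)
length-star []       = refl
length-star (_ ∷ xs) = cong (suc ∘ suc) (trans (length-star xs) (sym (+-suc (length xs) (length xs))))

star-evenLetters-! : ∀ L n j → j ≤ n + n →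
                     star (evenLetters L n) ! suc j ≡ symbol (parity (suc j)) (L (suc j))
star-evenLetters-! L zero    zero          _        = refl
star-evenLetters-! L (suc n) zero          _        = refl
star-evenLetters-! L (suc n) (suc zero)    _        = refl
star-evenLetters-! L (suc n) (suc (suc j)) (s≤s j<) =
  star-evenLetters-! (λ j → L (2 + j)) n j (s≤s⁻¹ (subst (suc j ≤_) (+-suc n n) j<))

module Construction (n : ℕ) (MP : ℕ → ℕ) where

  m : ℕ
  m = suc (n + n)

  code : ℕ → ℕ → ℕ
  code c k = c + k * suc m

  -- The head repeats the entry for c = a (whenever a ≤ m); it only makes the list nonempty.
  letterAt : ℕ → Letter
  letterAt a = code a 0 ∷⁺ map (λ c → code c ∣ a - c ∣) (filter (λ c → ∣ a - c ∣ ≤? MP c) (upTo (suc m)))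

  ∈-letterAt⁺ : ∀ {a c} → c ≤ m → ∣ a - c ∣ ≤ MP c → code c ∣ a - c ∣ ∈ toList (letterAt a)
  ∈-letterAt⁺ {a} {c} c≤m covered = there (∈-map∘filter⁺ (λ c → code c ∣ a - c ∣) (λ c → ∣ a - c ∣ ≤? MP c)
    (c , ∈-upTo⁺ (s≤s c≤m) , refl , covered))

  ∈-letterAt⁻ : ∀ {a x} → a ≤ m → x ∈ toList (letterAt a) →
                ∃[ c ] c ≤ m × ∣ a - c ∣ ≤ MP c × x ≡ code c ∣ a - c ∣
  ∈-letterAt⁻ {a} a≤m (here refl) =
    a , a≤m , subst (_≤ MP a) (sym (∣n-n∣≡0 a)) z≤n , cong (code a) (sym (∣n-n∣≡0 a))
  ∈-letterAt⁻ {a} a≤m (there x∈)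
    with c , c∈ , refl , covered ← ∈-map∘filter⁻ (λ c → code c ∣ a - c ∣) (λ c → ∣ a - c ∣ ≤? MP c) x∈ =
    c , s≤s⁻¹ (∈-upTo⁻ c∈) , covered , refl

  letterAt-≈ : ∀ {a b c} → c ≤ m → ∣ a - c ∣ ≡ ∣ b - c ∣ → ∣ a - c ∣ ≤ MP c → letterAt a ≈L letterAt b
  letterAt-≈ {a} {b} {c} c≤m same covered =
    code c ∣ a - c ∣ , ∈-letterAt⁺ c≤m covered ,
    subst (λ d → code c d ∈ toList (letterAt b)) (sym same) (∈-letterAt⁺ c≤m (subst (_≤ MP c) same covered))

  letterAt-≈⁻ : ∀ {a b} → a ≤ m → b ≤ m → a ≢ b → letterAt a ≈L letterAt b →
                ∃[ c ] a + b ≡ 2 * c × ∣ a - c ∣ ≤ MP c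
  letterAt-≈⁻ {a} {b} a≤m b≤m a≢b (x , x∈a , x∈b)
    with c , c≤m , covered , refl ← ∈-letterAt⁻ a≤m x∈a
       | c′ , c′≤m , _ , x≡ ← ∈-letterAt⁻ b≤m x∈b
    with refl , same ← m+kn-injective {k = ∣ a - c ∣} {k′ = ∣ b - c′ ∣} (s≤s c≤m) (s≤s c′≤m) x≡ =
    c , equidistant⇒a+b≡2c a≢b same , covered

  word : List Letter
  word = evenLetters letterAt n

  length-star-word : length (star word) ≡ m
  length-star-word = trans (length-star word) (cong (λ l → suc (l + l)) (length-evenLetters letterAt n))

  star-word-! : ∀ {j} → 1 ≤ j → j ≤ m → star word ! j ≡ symbol (parity j) (letterAt j)
  star-word-! {suc j} _ (s≤s j≤) = star-evenLetters-! letterAt n j j≤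

  module _ (admissible : Admissible m MP) where

    mirror-≈ : ∀ {i k} → 1 ≤ i → i ≤ m → k ≤ MP i → (star word ! (i ∸ k)) ≈ (star word ! (i + k))
    mirror-≈ {i} {k} 1≤i i≤m k≤r = subst₂ _≈_
      (sym (star-word-! (m<n⇒0<n∸m k<i) (≤-trans (m∸n≤m i k) i≤m)))
      (sym (star-word-! (≤-trans 1≤i (m≤m+n i k)) (≤-trans (+-monoʳ-≤ i k≤r) i+r≤m)))
      (subst (λ p → symbol (parity (i ∸ k)) (letterAt (i ∸ k)) ≈ symbol p (letterAt (i + k)))
        (sym (parity[m+n]≡parity[m∸n] k≤i))
        (symbol-≈ (parity (i ∸ k)) (letterAt-≈ i≤m
          (trans (∣[m∸n]-m∣≡n k≤i) (sym (∣[m+n]-m∣≡n i k)))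
          (subst (_≤ MP i) (sym (∣[m∸n]-m∣≡n k≤i)) k≤r))))
      where
      i+r≤m : i + MP i ≤ m
      i+r≤m = proj₁ (proj₂ (admissible i 1≤i i≤m))
      k<i : k < i
      k<i = ≤-<-trans k≤r (proj₁ (admissible i 1≤i i≤m))
      k≤i : k ≤ i
      k≤i = <⇒≤ k<i

    mirror-≉ : ∀ {i} → 1 ≤ i → suc (MP i) < i → i + suc (MP i) ≤ m →
               ¬ ((star word ! (i ∸ suc (MP i))) ≈ (star word ! (i + suc (MP i))))
    mirror-≉ {i} 1≤i k<i b≤m match = 1+n≰n (centre-covers (letterAt-≈⁻ a≤m b≤m a≢b letters))
      where
      k a b : ℕ
      k = suc (MP i)
      a = i ∸ k
      b = i + k
      k≤i : k ≤ i
      k≤i = <⇒≤ k<i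
      i≤b : i ≤ b
      i≤b = m≤m+n i k
      a≤m : a ≤ m
      a≤m = ≤-trans (m∸n≤m i k) (≤-trans i≤b b≤m)
      a≢b : a ≢ b
      a≢b = <⇒≢ (≤-<-trans (m∸n≤m i k) (m<m+n i z<s))
      parity[a]≡0ℙ : parity a ≡ 0ℙ
      parity[a]≡0ℙ = parity[m∸n]≡0ℙ k≤i (proj₂ (proj₂ (admissible i 1≤i (≤-trans i≤b b≤m))))
      letters : letterAt a ≈L letterAt b
      letters = subst₂ _≈_
        (trans (star-word-! (m<n⇒0<n∸m k<i) a≤m) (cong (λ p → symbol p (letterAt a)) parity[a]≡0ℙ))
        (trans (star-word-! (≤-trans 1≤i i≤b) b≤m)
               (cong (λ p → symbol p (letterAt b)) (trans (parity[m+n]≡parity[m∸n] k≤i) parity[a]≡0ℙ)))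
        match
      centre-covers : ∃[ c ] a + b ≡ 2 * c × ∣ a - c ∣ ≤ MP c → k ≤ MP i
      centre-covers (c , a+b≡2c , covered)
        with refl ← *-cancelˡ-≡ c i 2 (trans (sym a+b≡2c) ([m∸n]+[m+n]≡2m k≤i)) =
        subst (_≤ MP i) (∣[m∸n]-m∣≡n k≤i) covered

    isMP : ∀ i → 1 ≤ i → i ≤ m → IsMP (star word) i (MP i)
    isMP i 1≤i i≤m with r<i , i+r≤m , _ ← admissible i 1≤i i≤m =
      (m<n⇒0<n∸m r<i , r<i , subst (i + MP i ≤_) (sym length-star-word) i+r≤m ,
       λ k _ k≤r → mirror-≈ 1≤i i≤m k≤r) ,
      λ r′ (_ , r′<i , i+r′≤ , mirrors) → ≮⇒≥ λ r<r′ →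
        mirror-≉ 1≤i (≤-<-trans r<r′ r′<i)
          (≤-trans (+-monoʳ-≤ i r<r′) (subst (i + r′ ≤_) length-star-word i+r′≤))
          (mirrors (suc (MP i)) (s≤s z≤n) r<r′)

lemma6 : (m : ℕ) → 1 ≤ m → m % 2 ≡ 1 → (MP : ℕ → ℕ) → Feasible m MP →
    Σ (List Letter) (λ x → (length x ≡ (m ∸ 1) / 2) ×
      (∀ i → 1 ≤ i → i ≤ m → IsMP (star x) i (MP i)))
lemma6 m _ odd MP feasible =
  word , length-evenLetters letterAt h , λ i 1≤i i≤m → isMP admissible i 1≤i (subst (i ≤_) m≡1+[h+h] i≤m)
  where
  h : ℕ
  h = (m ∸ 1) / 2
  open Construction h MP using (word; letterAt; isMP)
  m≡1+[h+h] : m ≡ suc (h + h)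
  m≡1+[h+h] = %2≡1⇒m≡1+[h+h] m odd
  admissible : Admissible (suc (h + h)) MP
  admissible = subst (λ m → Admissible m MP) m≡1+[h+h] (feasible⇒admissible odd feasible)
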